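{- Let $m=2n+1\ge 5$ be odd and let $\varphi=(\mathcal A_1,\dots,\mathcal A_m)$ be a ring (as defined in the context). Then the ring graph of $\varphi$ has $m$ pairwise disjoint maximum independent sets (which then partition its vertex set) if and only if the ring graph is $m$-colorable.
   Context: Indices are taken cyclically modulo $m$. A ring is a sequence $\varphi=(\mathcal A_1,\dots,\mathcal A_m)$ of pairwise disjoint finite vertex sets such that $|\mathcal A_i|\ge 1$ and $|\mathcal A_i|+|\mathcal A_{i+1}|\le m$ for all $i$, and $\sum_{i=1}^m|\mathcal A_i| = m\lfloor m/2\rfloor$. The ring graph has vertex set $\bigcup_i\mathcal A_i$, two distinct vertices $u\in\mathcal A_i$, $v\in\mathcal A_j$ being adjacent iff $j\in\{i-1,i,i+1\}$ mod $m$; its maximum independent sets have size $n$. $m$-colorable means the vertices admit a proper coloring with $m$ colors. -}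

module Defs where

open import Data.Nat using (ℕ; zero; suc; _+_; _*_; _≤_; _/_)
open import Data.Nat.DivMod using (_mod_)
open import Data.Fin using (Fin; toℕ)
open import Data.List using (List; length; tabulate)
open import Data.Nat.ListAction using (sum)
open import Data.Empty using (⊥)
open import Data.List.Membership.Propositional using (_∈_)
open import Data.List.Relation.Unary.Unique.Propositional using (Unique)
open import Data.Product using (Σ; _×_; proj₁; ∃)
open import Data.Sum using (_⊎_)
open import Relation.Binary.PropositionalEquality using (_≡_; _≢_)
open import Relation.Nullary using (¬_)

next : {m : ℕ} → Fin m → Fin m
next {suc k} i = suc (toℕ i) mod suc k

-- A ring (A_1,…,A_m) is given (up to renaming of vertices) by the sizes
-- a i = |A_i|; the vertex set is the disjoint union Σ i, Fin (a i).
IsRing : (m : ℕ) → (Fin m → ℕ) → Set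
IsRing m a =
  (∀ i → 1 ≤ a i) ×
  (∀ i → a i + a (next i) ≤ m) ×
  (sum (tabulate a) ≡ m * (m / 2))

Vertex : (m : ℕ) → (Fin m → ℕ) → Set
Vertex m a = Σ (Fin m) (λ i → Fin (a i))

Adj : {m : ℕ} (a : Fin m → ℕ) → Vertex m a → Vertex m a → Set
Adj a u v =
  u ≢ v ×
  (proj₁ u ≡ proj₁ v ⊎ next (proj₁ u) ≡ proj₁ v ⊎ next (proj₁ v) ≡ proj₁ u)

IsIndependent : {m : ℕ} (a : Fin m → ℕ) → List (Vertex m a) → Set
IsIndependent a S =
  Unique S × (∀ u v → u ∈ S → v ∈ S → ¬ Adj a u v)

IsMaxIndependent : {m : ℕ} (a : Fin m → ℕ) → List (Vertex m a) → Set
IsMaxIndependent a S =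
  IsIndependent a S × (∀ T → IsIndependent a T → length T ≤ length S)

HasDisjointMaxIndependentSets : (m : ℕ) (a : Fin m → ℕ) → Set
HasDisjointMaxIndependentSets m a =
  Σ (Fin m → List (Vertex m a)) λ F →
    (∀ i → IsMaxIndependent a (F i)) ×
    (∀ i j → i ≢ j → ∀ v → v ∈ F i → v ∈ F j → ⊥)

IsColorable : (k : ℕ) {m : ℕ} (a : Fin m → ℕ) → Set
IsColorable k {m} a =
  Σ (Vertex m a → Fin k) λ c → ∀ u v → Adj a u v → c u ≢ c v

module Submission where

-- An independent set of the ring graph meets each class at most once and never two cyclically
-- consecutive classes, so its set I of classes is disjoint from I + 1 and 2|I| ≤ m; the first
-- vertices of the classes 0, 2, …, 2n − 2 form an independent set, so α = n, while |V| = m·n.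
-- In any graph with |V| = m·α, m disjoint maximum independent sets cover V and hence are the colour
-- classes of an m-colouring; conversely the m colour classes of an m-colouring are independent,
-- have size at most α and sum to m·α, so all of them are maximum.

open import Defs
open import Data.Nat using (ℕ; zero; suc; _+_; _*_; _≤_; _<_; _/_; _%_; z≤n; s≤s)
open import Data.Nat.Properties
open import Data.Nat.DivMod
  using (m<n⇒m%n≡m; n%n≡0; %-distribˡ-+; m%n%n≡m%n; [m+n]%n≡m%n; /-congˡ; +-distrib-/-∣ʳ; m*n/n≡m)
open import Data.Nat.Divisibility using (divides-refl)
open import Data.Nat.ListAction using (sum)
open import Data.Fin as Fin using (Fin; toℕ; fromℕ<)
open import Data.Fin.Properties using (toℕ-fromℕ<; toℕ-injective; toℕ<n; injective⇒≤)
open import Data.List using (List; _∷_; allFin; length; lookup; tabulate; concat; map; filter; _++_)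
open import Data.List.Properties using (length-++; length-map; length-tabulate; tabulate-cong)
open import Data.List.Membership.Propositional using (_∈_)
open import Data.List.Membership.Propositional.Properties
  using ( ∈-lookup; ∈-tabulate⁺; ∈-tabulate⁻; ∈-concat⁺; ∈-concat⁻
        ; ∈-filter⁺; ∈-filter⁻; ∈-map⁻; ∈-allFin)
open import Data.List.Membership.Setoid.Properties using (index-injective)
open import Data.List.Relation.Unary.Any as Any using (here; there; index)
import Data.List.Relation.Unary.Any.Properties as Any
import Data.List.Relation.Unary.All as All
open import Data.List.Relation.Unary.AllPairs using ([]; _∷_)
import Data.List.Relation.Unary.All.Properties as All
import Data.List.Relation.Unary.AllPairs.Properties as AllPairs
open import Data.List.Relation.Unary.Unique.Propositional using (Unique)
import Data.List.Relation.Unary.Unique.Propositional.Properties as Unique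
open import Data.List.Relation.Binary.Disjoint.Propositional using (Disjoint)
open import Data.Product using (Σ; _,_; proj₁; proj₂)
open import Data.Product.Properties using (≡-dec)
open import Data.Sum using (inj₁; inj₂)
open import Data.Empty using (⊥; ⊥-elim)
open import Function.Base using (_∘_; id)
open import Function.Bundles using (_⇔_; mk⇔)
open import Relation.Binary.Definitions using (DecidableEquality)
open import Relation.Binary.PropositionalEquality
open import Relation.Nullary using (¬_; yes; no)

module _ {A : Set} where

  lookup-injective : ∀ {xs : List A} → Unique xs → ∀ {i j} → lookup xs i ≡ lookup xs j → i ≡ j
  lookup-injective {_ ∷ _} _  {Fin.zero}  {Fin.zero}  _  = refl
  lookup-injective (x∉xs ∷ _) {Fin.zero}  {Fin.suc j} eq = ⊥-elim (All.lookup x∉xs (∈-lookup j) eq)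
  lookup-injective (x∉xs ∷ _) {Fin.suc i} {Fin.zero}  eq = ⊥-elim (All.lookup x∉xs (∈-lookup i) (sym eq))
  lookup-injective (_ ∷ xs!)  {Fin.suc i} {Fin.suc j} eq = cong Fin.suc (lookup-injective xs! eq)

  unique∧⊆⇒length≤ : ∀ {xs ys : List A} → Unique xs → (∀ {x} → x ∈ xs → x ∈ ys) → length xs ≤ length ys
  unique∧⊆⇒length≤ {xs} xs! xs⊆ys =
    injective⇒≤ {f = λ i → index (xs⊆ys (∈-lookup i))}
      λ eq → lookup-injective xs! (index-injective (setoid A) (xs⊆ys (∈-lookup _)) (xs⊆ys (∈-lookup _)) eq)

  map-unique : ∀ {B : Set} (f : A → B) {xs} → Unique xs →
               (∀ {x y} → x ∈ xs → y ∈ xs → f x ≡ f y → x ≡ y) → Unique (map f xs)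
  map-unique f []          _   = []
  map-unique f (x∉xs ∷ xs!) inj =
    All.map⁺ (All.tabulate λ y∈xs fx≡fy → All.lookup x∉xs y∈xs (inj (here refl) (there y∈xs) fx≡fy))
    ∷ map-unique f xs! (λ x∈ y∈ → inj (there x∈) (there y∈))

  unique∧length≥⇒∈ : DecidableEquality A → ∀ {xs ys : List A} → Unique xs → (∀ x → x ∈ ys) →
                      length ys ≤ length xs → ∀ x → x ∈ xs
  unique∧length≥⇒∈ _≟_ {xs} {ys} xs! complete ys≤xs x with Any.any? (x ≟_) xs
  ... | yes x∈xs = x∈xs
  ... | no  x∉xs = ⊥-elim (<⇒≱ (unique∧⊆⇒length≤ x∷xs! (λ {y} _ → complete y)) ys≤xs)
    where
    x∷xs! : Unique (x ∷ xs)
    x∷xs! = All.¬Any⇒All¬ xs x∉xs ∷ xs!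

  length-concat-tabulate : ∀ {m} (g : Fin m → List A) →
                           length (concat (tabulate g)) ≡ sum (tabulate (λ i → length (g i)))
  length-concat-tabulate {zero}  g = refl
  length-concat-tabulate {suc m} g =
    trans (length-++ (g Fin.zero)) (cong (length (g Fin.zero) +_) (length-concat-tabulate (g ∘ Fin.suc)))

  ∈-concat-tabulate⁺ : ∀ {m} (g : Fin m → List A) i {x} → x ∈ g i → x ∈ concat (tabulate g)
  ∈-concat-tabulate⁺ g i x∈gi = ∈-concat⁺ (Any.tabulate⁺ i x∈gi)

  ∈-concat-tabulate⁻ : ∀ {m} (g : Fin m → List A) {x} → x ∈ concat (tabulate g) → Σ (Fin m) λ i → x ∈ g i
  ∈-concat-tabulate⁻ g x∈ = Any.tabulate⁻ (∈-concat⁻ (tabulate g) x∈)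

  concat-tabulate-unique : ∀ {m} (g : Fin m → List A) → (∀ i → Unique (g i)) →
                           (∀ {i j} → i ≢ j → Disjoint (g i) (g j)) → Unique (concat (tabulate g))
  concat-tabulate-unique g g! disjoint = Unique.concat⁺ (All.tabulate⁺ g!) (AllPairs.tabulate⁺ disjoint)

m*n≤sum-tabulate : ∀ {m} n (f : Fin m → ℕ) → (∀ i → n ≤ f i) → m * n ≤ sum (tabulate f)
m*n≤sum-tabulate {zero}  n f n≤f = z≤n
m*n≤sum-tabulate {suc m} n f n≤f = +-mono-≤ (n≤f Fin.zero) (m*n≤sum-tabulate n (f ∘ Fin.suc) (n≤f ∘ Fin.suc))

sum-tabulate≤m*n : ∀ {m} n (f : Fin m → ℕ) → (∀ i → f i ≤ n) → sum (tabulate f) ≤ m * n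
sum-tabulate≤m*n {zero}  n f f≤n = z≤n
sum-tabulate≤m*n {suc m} n f f≤n = +-mono-≤ (f≤n Fin.zero) (sum-tabulate≤m*n n (f ∘ Fin.suc) (f≤n ∘ Fin.suc))

sum-tabulate<m*n : ∀ {m} n (f : Fin m → ℕ) → (∀ i → f i ≤ n) → ∀ i → f i < n → sum (tabulate f) < m * n
sum-tabulate<m*n {suc m} n f f≤n Fin.zero    fi<n =
  +-mono-<-≤ fi<n (sum-tabulate≤m*n n (f ∘ Fin.suc) (f≤n ∘ Fin.suc))
sum-tabulate<m*n {suc m} n f f≤n (Fin.suc i) fi<n =
  +-mono-≤-< (f≤n Fin.zero) (sum-tabulate<m*n n (f ∘ Fin.suc) (f≤n ∘ Fin.suc) i fi<n)

module _ {m} (a : Fin m → ℕ) where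

  _≟ᵥ_ : DecidableEquality (Vertex m a)
  _≟ᵥ_ = ≡-dec Fin._≟_ Fin._≟_

  classVertices : Fin m → List (Vertex m a)
  classVertices i = tabulate {A = Vertex m a} (i ,_)

  vertices : List (Vertex m a)
  vertices = concat (tabulate classVertices)

  ∈-vertices : ∀ v → v ∈ vertices
  ∈-vertices (i , k) = ∈-concat-tabulate⁺ classVertices i (∈-tabulate⁺ k)

  vertices-unique : Unique vertices
  vertices-unique = concat-tabulate-unique classVertices
    (λ i → Unique.tabulate⁺ λ { refl → refl })
    (λ i≢j (v∈i , v∈j) → i≢j (trans (sym (class-of v∈i)) (class-of v∈j)))
    where
    class-of : ∀ {i v} → v ∈ classVertices i → proj₁ v ≡ i
    class-of v∈ = cong proj₁ (proj₂ (∈-tabulate⁻ v∈))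

  length-vertices : length vertices ≡ sum (tabulate a)
  length-vertices = trans (length-concat-tabulate classVertices)
    (cong sum (tabulate-cong {g = a} (λ i → length-tabulate _)))

  module _ (T₀ : List (Vertex m a)) (T₀-max : IsMaxIndependent a T₀)
           (order≡m*α : sum (tabulate a) ≡ m * length T₀) where

    private
      α = length T₀

    disjointMaxIndependent⇒colorable : HasDisjointMaxIndependentSets m a → IsColorable m a
    disjointMaxIndependent⇒colorable (F , F-max , F-disjoint) = colour , proper
      where
      F-independent : ∀ i → IsIndependent a (F i)
      F-independent i = proj₁ (F-max i)

      α≤F : ∀ i → α ≤ length (F i)
      α≤F i = proj₂ (F-max i) T₀ (proj₁ T₀-max)

      covered : ∀ v → v ∈ concat (tabulate F)
      covered = unique∧length≥⇒∈ _≟ᵥ_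
        (concat-tabulate-unique F (proj₁ ∘ F-independent) (λ i≢j (v∈i , v∈j) → F-disjoint _ _ i≢j _ v∈i v∈j))
        ∈-vertices
        (begin
          length vertices                      ≡⟨ length-vertices ⟩
          sum (tabulate a)                     ≡⟨ order≡m*α ⟩
          m * α                                ≤⟨ m*n≤sum-tabulate α (length ∘ F) α≤F ⟩
          sum (tabulate (length ∘ F))          ≡⟨ length-concat-tabulate F ⟨
          length (concat (tabulate F))         ∎)
        where open ≤-Reasoning

      colour : Vertex m a → Fin m
      colour v = proj₁ (∈-concat-tabulate⁻ F (covered v))

      ∈-F-colour : ∀ v → v ∈ F (colour v)
      ∈-F-colour v = proj₂ (∈-concat-tabulate⁻ F (covered v))

      proper : ∀ u v → Adj a u v → colour u ≢ colour v
      proper u v u~v eq =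
        proj₂ (F-independent (colour u)) u v (∈-F-colour u) (subst (λ i → v ∈ F i) (sym eq) (∈-F-colour v)) u~v

    colorable⇒disjointMaxIndependent : IsColorable m a → HasDisjointMaxIndependentSets m a
    colorable⇒disjointMaxIndependent (colour , proper) = colourClass , colourClass-max , colourClass-disjoint
      where
      colourClass : Fin m → List (Vertex m a)
      colourClass c = filter (λ v → colour v Fin.≟ c) vertices

      ∈-own-colourClass : ∀ v → v ∈ concat (tabulate colourClass)
      ∈-own-colourClass v = ∈-concat-tabulate⁺ colourClass (colour v) (∈-filter⁺ _ (∈-vertices v) refl)

      coloured : ∀ {c v} → v ∈ colourClass c → colour v ≡ c
      coloured {c} v∈ = proj₂ (∈-filter⁻ (λ v → colour v Fin.≟ c) {xs = vertices} v∈)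

      colourClass-independent : ∀ c → IsIndependent a (colourClass c)
      colourClass-independent c = Unique.filter⁺ _ vertices-unique ,
        λ u v u∈ v∈ u~v → proper u v u~v (trans (coloured u∈) (sym (coloured v∈)))

      colourClass-≤α : ∀ c → length (colourClass c) ≤ α
      colourClass-≤α c = proj₂ T₀-max _ (colourClass-independent c)

      m*α≤total : m * α ≤ sum (tabulate (length ∘ colourClass))
      m*α≤total = begin
        m * α                                   ≡⟨ order≡m*α ⟨
        sum (tabulate a)                        ≡⟨ length-vertices ⟨
        length vertices                         ≤⟨ unique∧⊆⇒length≤ vertices-unique (λ {v} _ → ∈-own-colourClass v) ⟩
        length (concat (tabulate colourClass))  ≡⟨ length-concat-tabulate colourClass ⟩
        sum (tabulate (length ∘ colourClass))   ∎
        where open ≤-Reasoning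

      α≤colourClass : ∀ c → α ≤ length (colourClass c)
      α≤colourClass c = ≮⇒≥ λ short →
        <⇒≱ (sum-tabulate<m*n α (length ∘ colourClass) colourClass-≤α c short) m*α≤total

      colourClass-max : ∀ c → IsMaxIndependent a (colourClass c)
      colourClass-max c = colourClass-independent c , λ T T-indep → ≤-trans (proj₂ T₀-max T T-indep) (α≤colourClass c)

      colourClass-disjoint : ∀ i j → i ≢ j → ∀ v → v ∈ colourClass i → v ∈ colourClass j → ⊥
      colourClass-disjoint i j i≢j v v∈i v∈j = i≢j (trans (sym (coloured v∈i)) (coloured v∈j))

    disjointMaxIndependent⇔colorable : HasDisjointMaxIndependentSets m a ⇔ IsColorable m a
    disjointMaxIndependent⇔colorable = mk⇔ disjointMaxIndependent⇒colorable colorable⇒disjointMaxIndependent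

module _ {k : ℕ} where

  toℕ-next : (i : Fin (suc k)) → toℕ (next i) ≡ suc (toℕ i) % suc k
  toℕ-next i = toℕ-fromℕ< _

  toℕ-next-< : (i : Fin (suc k)) → suc (toℕ i) < suc k → toℕ (next i) ≡ suc (toℕ i)
  toℕ-next-< i i+1<m = trans (toℕ-next i) (m<n⇒m%n≡m i+1<m)

  toℕ≡[toℕ-next+k]%[1+k] : (i : Fin (suc k)) → toℕ i ≡ (toℕ (next i) + k) % suc k
  toℕ≡[toℕ-next+k]%[1+k] i = begin
    toℕ i                                   ≡⟨ m<n⇒m%n≡m (toℕ<n i) ⟨
    t % suc k                               ≡⟨ [m+n]%n≡m%n t (suc k) ⟨
    (t + suc k) % suc k                     ≡⟨ cong (_% suc k) (+-suc t k) ⟩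
    (suc t + k) % suc k                     ≡⟨ %-distribˡ-+ (suc t) k (suc k) ⟩
    (suc t % suc k + k % suc k) % suc k     ≡⟨ cong (λ x → (x + k % suc k) % suc k) (m%n%n≡m%n (suc t) (suc k)) ⟨
    (suc t % suc k % suc k + k % suc k) % suc k ≡⟨ %-distribˡ-+ (suc t % suc k) k (suc k) ⟨
    (suc t % suc k + k) % suc k             ≡⟨ cong (λ x → (x + k) % suc k) (toℕ-next i) ⟨
    (toℕ (next i) + k) % suc k              ∎
    where
    open ≡-Reasoning
    t = toℕ i

  next-injective : ∀ {i j : Fin (suc k)} → next i ≡ next j → i ≡ j
  next-injective {i} {j} eq = toℕ-injective (begin
    toℕ i                          ≡⟨ toℕ≡[toℕ-next+k]%[1+k] i ⟩
    (toℕ (next i) + k) % suc k     ≡⟨ cong (λ x → (toℕ x + k) % suc k) eq ⟩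
    (toℕ (next j) + k) % suc k     ≡⟨ toℕ≡[toℕ-next+k]%[1+k] j ⟨
    toℕ j                          ∎)
    where open ≡-Reasoning

next[i]≢i : ∀ {k} (i : Fin (suc (suc k))) → next i ≢ i
next[i]≢i {k} i eq with m≤n⇒m<n∨m≡n (toℕ<n i)
... | inj₁ i+1<m = 1+n≢n (trans (sym (toℕ-next-< i i+1<m)) (cong toℕ eq))
... | inj₂ i+1≡m = 0≢1+n (begin
  0                                 ≡⟨ n%n≡0 (suc (suc k)) ⟨
  suc (suc k) % suc (suc k)         ≡⟨ cong (_% suc (suc k)) i+1≡m ⟨
  suc (toℕ i) % suc (suc k)         ≡⟨ toℕ-next i ⟨
  toℕ (next i)                      ≡⟨ cong toℕ eq ⟩
  toℕ i                             ≡⟨ suc-injective i+1≡m ⟩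
  suc k                             ∎)
  where open ≡-Reasoning

module _ {m} {a : Fin m → ℕ} {T : List (Vertex m a)} (T-indep : IsIndependent a T) {u v} (u∈T : u ∈ T) (v∈T : v ∈ T) where

  independent-sameClass⇒≡ : proj₁ u ≡ proj₁ v → u ≡ v
  independent-sameClass⇒≡ same with _≟ᵥ_ a u v
  ... | yes u≡v = u≡v
  ... | no  u≢v = ⊥-elim (proj₂ T-indep u v u∈T v∈T (u≢v , inj₁ same))

module _ {k} {a : Fin (suc (suc k)) → ℕ} {T} (T-indep : IsIndependent a T) {u v} (u∈T : u ∈ T) (v∈T : v ∈ T) where

  independent⇒nonconsecutive : next (proj₁ u) ≢ proj₁ v
  independent⇒nonconsecutive consecutive with _≟ᵥ_ a u v
  ... | yes refl = next[i]≢i (proj₁ u) consecutive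
  ... | no  u≢v  = proj₂ T-indep u v u∈T v∈T (u≢v , inj₂ (inj₁ consecutive))

independent⇒length+length≤m : ∀ {k} {a : Fin (suc (suc k)) → ℕ} {T} → IsIndependent a T →
                              length T + length T ≤ suc (suc k)
independent⇒length+length≤m {k} {a} {T} T-indep = begin
  length T + length T                  ≡⟨ cong₂ _+_ (length-map proj₁ T) (trans (length-map next classes) (length-map proj₁ T)) ⟨
  length classes + length nextClasses  ≡⟨ length-++ classes ⟨
  length (classes ++ nextClasses)      ≤⟨ unique∧⊆⇒length≤ classes++nextClasses! (λ {i} _ → ∈-allFin i) ⟩
  length (allFin (suc (suc k)))        ≡⟨ length-tabulate id ⟩
  suc (suc k)                          ∎
  where
  open ≤-Reasoning
  classes nextClasses : List (Fin (suc (suc k)))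
  classes     = map proj₁ T
  nextClasses = map next classes

  classes! : Unique classes
  classes! = map-unique proj₁ (proj₁ T-indep) (independent-sameClass⇒≡ T-indep)

  disjoint : Disjoint classes nextClasses
  disjoint (i∈classes , i∈nextClasses)
    with u , u∈T , refl ← ∈-map⁻ proj₁ i∈classes
       | j , j∈classes , i≡next-j ← ∈-map⁻ next i∈nextClasses
    with w , w∈T , refl ← ∈-map⁻ proj₁ j∈classes
    = independent⇒nonconsecutive T-indep w∈T u∈T (sym i≡next-j)

  classes++nextClasses! : Unique (classes ++ nextClasses)
  classes++nextClasses! = Unique.++⁺ classes! (Unique.map⁺ next-injective classes!) disjoint

2*n≡n+n : ∀ n → 2 * n ≡ n + n
2*n≡n+n n = cong (n +_) (+-identityʳ n)

[1+n+n]/2≡n : ∀ n → suc (n + n) / 2 ≡ n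
[1+n+n]/2≡n n = begin
  suc (n + n) / 2      ≡⟨ /-congˡ {o = 2} (cong suc (trans (sym (2*n≡n+n n)) (*-comm 2 n))) ⟩
  (1 + n * 2) / 2      ≡⟨ +-distrib-/-∣ʳ 1 {d = 2} (divides-refl n) ⟩
  1 / 2 + n * 2 / 2    ≡⟨ m*n/n≡m n 2 ⟩
  n                    ∎
  where open ≡-Reasoning

t+t≤1+n+n⇒t≤n : ∀ {t n} → t + t ≤ suc (n + n) → t ≤ n
t+t≤1+n+n⇒t≤n {t} {n} t+t≤ = ≮⇒≥ λ n<t → 1+n≰n (begin
  suc (suc (n + n))    ≡⟨ cong suc (+-suc n n) ⟨
  suc n + suc n        ≤⟨ +-mono-≤ n<t n<t ⟩
  t + t                ≤⟨ t+t≤ ⟩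
  suc (n + n)          ∎)
  where open ≤-Reasoning

module _ (n : ℕ) (a : Fin (suc (n + n)) → ℕ) (nonempty : ∀ i → 1 ≤ a i) where

  2k<n+n : (k : Fin n) → 2 * toℕ k < n + n
  2k<n+n k = subst (2 * toℕ k <_) (2*n≡n+n n) (*-monoʳ-< 2 (toℕ<n k))

  evenClass : Fin n → Fin (suc (n + n))
  evenClass k = fromℕ< (m<n⇒m<1+n (2k<n+n k))

  toℕ-evenClass : ∀ k → toℕ (evenClass k) ≡ 2 * toℕ k
  toℕ-evenClass k = toℕ-fromℕ< _

  evenClass-injective : ∀ {k l} → evenClass k ≡ evenClass l → k ≡ l
  evenClass-injective {k} {l} eq = toℕ-injective (*-cancelˡ-≡ (toℕ k) (toℕ l) 2
    (trans (sym (toℕ-evenClass k)) (trans (cong toℕ eq) (toℕ-evenClass l))))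

  next-evenClass≢evenClass : ∀ k l → next (evenClass k) ≢ evenClass l
  next-evenClass≢evenClass k l eq = even≢odd (toℕ l) (toℕ k) (begin
    2 * toℕ l                   ≡⟨ toℕ-evenClass l ⟨
    toℕ (evenClass l)           ≡⟨ cong toℕ eq ⟨
    toℕ (next (evenClass k))    ≡⟨ toℕ-next-< (evenClass k) 1+evenClass<m ⟩
    suc (toℕ (evenClass k))     ≡⟨ cong suc (toℕ-evenClass k) ⟩
    suc (2 * toℕ k)             ∎)
    where
    open ≡-Reasoning
    1+evenClass<m : suc (toℕ (evenClass k)) < suc (n + n)
    1+evenClass<m = subst (λ x → suc x < suc (n + n)) (sym (toℕ-evenClass k)) (s≤s (2k<n+n k))

  evenVertex : Fin n → Vertex (suc (n + n)) a
  evenVertex k = evenClass k , fromℕ< (nonempty (evenClass k))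

  evenVertices : List (Vertex (suc (n + n)) a)
  evenVertices = tabulate evenVertex

  length-evenVertices : length evenVertices ≡ n
  length-evenVertices = length-tabulate evenVertex

  evenVertices-independent : IsIndependent a evenVertices
  evenVertices-independent = Unique.tabulate⁺ (evenClass-injective ∘ cong proj₁) , nonadjacent
    where
    nonadjacent : ∀ u v → u ∈ evenVertices → v ∈ evenVertices → ¬ Adj a u v
    nonadjacent _ _ u∈ v∈ adj with k , refl ← ∈-tabulate⁻ u∈ | l , refl ← ∈-tabulate⁻ v∈ with adj
    ... | u≢v , inj₁ same              = u≢v (cong evenVertex (evenClass-injective {k} {l} same))
    ... | _   , inj₂ (inj₁ next-k≡l)   = next-evenClass≢evenClass k l next-k≡l
    ... | _   , inj₂ (inj₂ next-l≡k)   = next-evenClass≢evenClass l k next-l≡k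

evenVertices-maximum : ∀ n (a : Fin (suc (n + n)) → ℕ) → 1 ≤ n → (nonempty : ∀ i → 1 ≤ a i) →
                       IsMaxIndependent a (evenVertices n a nonempty)
evenVertices-maximum (suc n) a _ nonempty = evenVertices-independent (suc n) a nonempty , λ T T-indep →
  subst (length T ≤_) (sym (length-evenVertices (suc n) a nonempty))
    (t+t≤1+n+n⇒t≤n (independent⇒length+length≤m T-indep))

lemma2p12 : (n : ℕ) → 2 ≤ n → (a : Fin (suc (n + n)) → ℕ) → IsRing (suc (n + n)) a →
    HasDisjointMaxIndependentSets (suc (n + n)) a ⇔ IsColorable (suc (n + n)) a
lemma2p12 n 2≤n a (nonempty , _ , order≡m*[m/2]) =
  disjointMaxIndependent⇔colorable a (evenVertices n a nonempty) (evenVertices-maximum n a (<⇒≤ 2≤n) nonempty) (begin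
    sum (tabulate a)                        ≡⟨ order≡m*[m/2] ⟩
    suc (n + n) * (suc (n + n) / 2)         ≡⟨ cong (suc (n + n) *_) ([1+n+n]/2≡n n) ⟩
    suc (n + n) * n                         ≡⟨ cong (suc (n + n) *_) (length-evenVertices n a nonempty) ⟨
    suc (n + n) * length (evenVertices n a nonempty) ∎)
  where open ≡-Reasoning
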